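{- Let $p$ be a prime. (a) Let $W\subset \mathbb{Z}_p$ be a nonempty set of residues with \[ |W| < \frac{p-1}{2} - \frac{\log p}{\log (4/3)}. \] Then there exist nonempty sets $U,V\subset\mathbb{Z}_p$ forming a prime-compatible pair modulo $p$ with $W\subset U$ and $W\subset V$. (b) If $p\ge 7$, there exist nonempty sets $U,V\subset\mathbb{Z}_p$ forming a prime-compatible pair modulo $p$ such that the residues of $1$ and $11$ modulo $p$ lie in $U\setminus V$, the residue of $6$ modulo $p$ lies in $V\setminus U$, and $|U\cap V|=2$.
   Context: $\mathbb{Z}_p$ denotes the integers modulo $p$ and $\mathbb{Z}_p^*=\mathbb{Z}_p\setminus\{0\}$. For a prime $p$, two nonempty sets $U,V\subset\mathbb{Z}_p$ form a prime-compatible pair (modulo $p$) if \[ (U\setminus V)-(V\setminus U) = \{u-v : u\in U\setminus V,\ v\in V\setminus U\} = \mathbb{Z}_p^*. \] $\log$ denotes the natural logarithm. -}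

module Defs where

open import Data.Nat using (ℕ; _+_; _∸_; NonZero)
open import Data.Nat.DivMod using (_%_; m%n<n)
open import Data.Nat.Primality using (Prime; prime⇒nonZero)
open import Data.Fin using (Fin; toℕ; fromℕ<)
open import Data.Fin.Subset using (Subset; _∈_; _─_)
open import Data.Product using (∃; ∃-syntax; _×_)
open import Relation.Binary.PropositionalEquality using (_≡_; _≢_)
open import Function.Bundles using (_⇔_)

res : (p : ℕ) → Prime p → ℕ → Fin p
res p pr m = let instance _ = prime⇒nonZero pr in fromℕ< (m%n<n m p)

sub : (p : ℕ) → Prime p → Fin p → Fin p → Fin p
sub p pr u v = res p pr (toℕ u + (p ∸ toℕ v))

-- (U \ V) - (V \ U) = Z_p^*  (set equality, written pointwise)
PrimeCompatible : (p : ℕ) → Prime p → Subset p → Subset p → Set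
PrimeCompatible p pr U V =
  ∀ (d : Fin p) →
    (toℕ d ≢ 0) ⇔ (∃[ u ] ∃[ v ] (u ∈ (U ─ V) × v ∈ (V ─ U) × sub p pr u v ≡ d))

-- (a) is the probabilistic method, with probabilities replaced by counts over the 2 ^ p subsets
-- C of ℤ_p.  Put U = W ∪ C and V = W ∪ ∁ C, so that U ─ V = C ─ W and V ─ U = ∁ C ─ W.  For
-- d ≢ 0 the orbit 0, d, 2d, …, (p − 1)d lists ℤ_p without repetition; cutting it into consecutive
-- pairs (a , a + d) gives ⌊p/2⌋ disjoint pairs, of which at most ∣ W ∣ meet W.  Each of the
-- m ≥ (p − 1)/2 − ∣ W ∣ remaining pairs realises d (a ∉ C, a + d ∈ C) for a quarter of all C,
-- independently of the others, so d is realised by no pair for a fraction (3/4)^m < 1/p of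
-- all C; the hypothesis p² 3^k < 4^k with k = p − 1 − 2∣ W ∣ is the squared form of this
-- bound.  A union bound over the nonzero d leaves a C that realises every one of them.
--
-- (b) is the same construction with W = {31, 51} and C = {1, 11}.  For d ≢ 0 one of 1 − d and
-- 11 − d lies outside {1, 11, 31, 51}: otherwise two elements of that set would differ by 10
-- modulo p, forcing p to divide one of 10, 20, 30, 40, 60, which is impossible for p ≥ 7.

module Submission where

import Algebra.Properties.CommutativeSemigroup as CommSemigroupProperties
open import Data.Bool using (Bool; true; false; not; _∨_; if_then_else_)
open import Data.Empty using (⊥; ⊥-elim)
open import Data.Fin using (Fin; zero; suc; toℕ)
open import Data.Fin.Properties using (toℕ-fromℕ<; toℕ-injective; toℕ<n)
open import Data.Fin.Subset hiding (⊥)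
open import Data.Fin.Subset.Properties
open import Data.List using (List; []; _∷_; length; map; allFin; applyUpTo)
open import Data.List.Membership.Propositional using () renaming (_∈_ to _∈ˡ_)
open import Data.List.Membership.Propositional.Properties using (∈-allFin)
open import Data.List.Properties using (length-tabulate; length-applyUpTo)
open import Data.List.Relation.Unary.Linked as Linked using (Linked; []; [-]; _∷_)
import Data.List.Relation.Unary.Linked.Properties as Linked
open import Data.List.Relation.Unary.All as All using (All; []; _∷_)
open import Data.List.Relation.Unary.Any using (Any; here; there)
open import Data.List.Relation.Unary.Unique.Propositional using (Unique; []; _∷_)
import Data.List.Relation.Unary.Unique.Propositional.Properties as Unique
open import Data.Nat
  using (ℕ; zero; suc; _+_; _*_; _∸_; _^_; _<_; _≤_; _<?_; _≟_; z≤n; s≤s; NonZero; >-nonZero⁻¹)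
open import Data.Nat.DivMod
open import Data.Nat.Divisibility using (_∣_; _∣?_; ∣-trans; m%n≡0⇒n∣m; ∣⇒≤)
open import Data.Nat.ListAction using (sum)
open import Data.Nat.Primality using (Prime; prime⇒nonZero; euclidsLemma)
open import Data.Nat.Properties
open import Data.Nat.Tactic.RingSolver using (solve-∀)
open import Data.Product using (∃-syntax; _,_; _×_; uncurry)
open import Data.Sum using (_⊎_; inj₁; inj₂; [_,_]′)
import Data.Sum as Sum
open import Data.Vec using ([]; _∷_; here; there; lookup; _[_]%=_; _[_]≔_)
open import Data.Vec.Properties
  using (lookup∘updateAt; lookup∘updateAt′; lookup∘update′; []=⇒lookup; lookup⇒[]=)
open import Function using (_∘_; flip)
open import Function.Bundles using (mk⇔)
open import Relation.Nullary using (¬_; Dec; yes; no; contradiction)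
open import Relation.Nullary.Decidable using (True; toWitness)
open import Relation.Binary.PropositionalEquality

open import Defs

open CommSemigroupProperties +-commutativeSemigroup using (interchange)
open CommSemigroupProperties *-commutativeSemigroup using (x∙yz≈y∙xz)

sumSubsets : ∀ n → (Subset n → ℕ) → ℕ
sumSubsets zero f = f []
sumSubsets (suc n) f = sumSubsets n (f ∘ (outside ∷_)) + sumSubsets n (f ∘ (inside ∷_))

sumSubsets-cong : ∀ {n} {f g : Subset n → ℕ} → (∀ c → f c ≡ g c) →
                  sumSubsets n f ≡ sumSubsets n g
sumSubsets-cong {zero} f≗g = f≗g []
sumSubsets-cong {suc n} f≗g =
  cong₂ _+_ (sumSubsets-cong (f≗g ∘ (outside ∷_))) (sumSubsets-cong (f≗g ∘ (inside ∷_)))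

sumSubsets-+ : ∀ {n} (f g : Subset n → ℕ) →
               sumSubsets n (λ c → f c + g c) ≡ sumSubsets n f + sumSubsets n g
sumSubsets-+ {zero} f g = refl
sumSubsets-+ {suc n} f g =
  trans (cong₂ _+_ (sumSubsets-+ (f ∘ (outside ∷_)) (g ∘ (outside ∷_)))
                   (sumSubsets-+ (f ∘ (inside ∷_)) (g ∘ (inside ∷_))))
        (interchange (sumSubsets n (f ∘ (outside ∷_))) (sumSubsets n (g ∘ (outside ∷_)))
                     (sumSubsets n (f ∘ (inside ∷_))) (sumSubsets n (g ∘ (inside ∷_))))

sumSubsets-* : ∀ {n} k (f : Subset n → ℕ) → sumSubsets n (λ c → k * f c) ≡ k * sumSubsets n f
sumSubsets-* {zero} k f = refl
sumSubsets-* {suc n} k f =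
  trans (cong₂ _+_ (sumSubsets-* {n} k _) (sumSubsets-* {n} k _)) (sym (*-distribˡ-+ k _ _))

sumSubsets-const : ∀ {n} k → sumSubsets n (λ _ → k) ≡ 2 ^ n * k
sumSubsets-const {zero} k = sym (+-identityʳ k)
sumSubsets-const {suc n} k = begin
  sumSubsets n (λ _ → k) + sumSubsets n (λ _ → k)
    ≡⟨ cong₂ _+_ (sumSubsets-const {n} k) (sumSubsets-const {n} k) ⟩
  2 ^ n * k + 2 ^ n * k
    ≡⟨ double (2 ^ n) k ⟩
  2 * 2 ^ n * k ∎
  where
  open ≡-Reasoning
  double : ∀ a b → a * b + a * b ≡ 2 * a * b
  double = solve-∀

toggle : ∀ {n} → Fin n → Subset n → Subset n
toggle i c = c [ i ]%= not

sumSubsets-toggle : ∀ {n} (i : Fin n) (f : Subset n → ℕ) →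
                    sumSubsets n (f ∘ toggle i) ≡ sumSubsets n f
sumSubsets-toggle {suc n} zero f =
  +-comm (sumSubsets n (f ∘ (inside ∷_))) (sumSubsets n (f ∘ (outside ∷_)))
sumSubsets-toggle {suc n} (suc i) f =
  cong₂ _+_ (sumSubsets-toggle i (f ∘ (outside ∷_))) (sumSubsets-toggle i (f ∘ (inside ∷_)))

sumSubsets<2^n⇒∃≡0 : ∀ {n} (f : Subset n → ℕ) → sumSubsets n f < 2 ^ n → ∃[ c ] f c ≡ 0
sumSubsets<2^n⇒∃≡0 {zero} f Σ<1 = [] , n<1⇒n≡0 Σ<1
sumSubsets<2^n⇒∃≡0 {suc n} f Σ<2^[1+n] with sumSubsets n (f ∘ (outside ∷_)) <? 2 ^ n
... | yes Σ₀<2^n = let c , fc≡0 = sumSubsets<2^n⇒∃≡0 _ Σ₀<2^n in outside ∷ c , fc≡0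
... | no Σ₀≮2^n = let c , fc≡0 = sumSubsets<2^n⇒∃≡0 _ Σ₁<2^n in inside ∷ c , fc≡0
  where
  Σ₁<2^n : sumSubsets n (f ∘ (inside ∷_)) < 2 ^ n
  Σ₁<2^n = +-cancelˡ-< (2 ^ n) _ _ (begin-strict
    2 ^ n + sumSubsets n (f ∘ (inside ∷_))                             ≤⟨ +-monoˡ-≤ _ (≮⇒≥ Σ₀≮2^n) ⟩
    sumSubsets n (f ∘ (outside ∷_)) + sumSubsets n (f ∘ (inside ∷_))   <⟨ Σ<2^[1+n] ⟩
    2 * 2 ^ n                                                          ≡⟨ cong (2 ^ n +_) (+-identityʳ _) ⟩
    2 ^ n + 2 ^ n                                                      ∎)
    where open ≤-Reasoning

sumSubsets-sum : ∀ {n} {A : Set} (xs : List A) (f : A → Subset n → ℕ) →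
  sumSubsets n (λ c → sum (map (λ x → f x c) xs)) ≡ sum (map (λ x → sumSubsets n (f x)) xs)
sumSubsets-sum {n} [] f = trans (sumSubsets-const {n} 0) (*-zeroʳ (2 ^ n))
sumSubsets-sum {n} (x ∷ xs) f =
  trans (sumSubsets-+ (f x) (λ c → sum (map (λ y → f y c) xs)))
        (cong (sumSubsets n (f x) +_) (sumSubsets-sum xs f))

sumBool₂ : (Bool → Bool → ℕ) → ℕ
sumBool₂ g = g true true + g false true + g true false + g false false

sumBool₂-not : ∀ (g : Bool → Bool → ℕ) x y →
               g x y + g (not x) y + g x (not y) + g (not x) (not y) ≡ sumBool₂ g
sumBool₂-not g true true = refl
sumBool₂-not g false true = swap₁ (g true true) (g false true) (g true false) (g false false)
  where swap₁ : ∀ a b c d → b + a + d + c ≡ a + b + c + d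
        swap₁ = solve-∀
sumBool₂-not g true false = swap₂ (g true true) (g false true) (g true false) (g false false)
  where swap₂ : ∀ a b c d → c + d + a + b ≡ a + b + c + d
        swap₂ = solve-∀
sumBool₂-not g false false = swap₃ (g true true) (g false true) (g true false) (g false false)
  where swap₃ : ∀ a b c d → d + c + b + a ≡ a + b + c + d
        swap₃ = solve-∀

-- Summing h over the four toggles of a and b meets every value of g once and leaves f unchanged.
module _ {n} {a b : Fin n} (a≢b : a ≢ b) (g : Bool → Bool → ℕ) (f : Subset n → ℕ)
         (f∘toggle-a : ∀ c → f (toggle a c) ≡ f c) (f∘toggle-b : ∀ c → f (toggle b c) ≡ f c) where

  private
    h : Subset n → ℕ
    h c = g (lookup c a) (lookup c b) * f c

    h-toggles : ∀ c → h c + h (toggle a c) + h (toggle b c) + h (toggle a (toggle b c))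
                      ≡ sumBool₂ g * f c
    h-toggles c = begin
      h c + h (toggle a c) + h (toggle b c) + h (toggle a (toggle b c))
        ≡⟨ cong₂ _+_ (cong₂ _+_ (cong (h c +_) ha) hb) hab ⟩
      g x y * f c + g (not x) y * f c + g x (not y) * f c + g (not x) (not y) * f c
        ≡⟨ distrib (g x y) (g (not x) y) (g x (not y)) (g (not x) (not y)) (f c) ⟩
      (g x y + g (not x) y + g x (not y) + g (not x) (not y)) * f c
        ≡⟨ cong (_* f c) (sumBool₂-not g x y) ⟩
      sumBool₂ g * f c ∎
      where
      open ≡-Reasoning
      x y : Bool
      x = lookup c a
      y = lookup c b
      distrib : ∀ p q r s t → p * t + q * t + r * t + s * t ≡ (p + q + r + s) * t
      distrib = solve-∀
      ha : h (toggle a c) ≡ g (not x) y * f c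
      ha = cong₂ _*_ (cong₂ g (lookup∘updateAt a c) (lookup∘updateAt′ b a (a≢b ∘ sym) c)) (f∘toggle-a c)
      hb : h (toggle b c) ≡ g x (not y) * f c
      hb = cong₂ _*_ (cong₂ g (lookup∘updateAt′ a b a≢b c) (lookup∘updateAt b c)) (f∘toggle-b c)
      hab : h (toggle a (toggle b c)) ≡ g (not x) (not y) * f c
      hab = cong₂ _*_
        (cong₂ g (trans (lookup∘updateAt a (toggle b c)) (cong not (lookup∘updateAt′ a b a≢b c)))
                 (trans (lookup∘updateAt′ b a (a≢b ∘ sym) (toggle b c)) (lookup∘updateAt b c)))
        (trans (f∘toggle-a (toggle b c)) (f∘toggle-b c))

  sumSubsets-pair : 4 * sumSubsets n (λ c → g (lookup c a) (lookup c b) * f c)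
                    ≡ sumBool₂ g * sumSubsets n f
  sumSubsets-pair = begin
    4 * sumSubsets n h
      ≡⟨ four (sumSubsets n h) ⟩
    sumSubsets n h + sumSubsets n h + sumSubsets n h + sumSubsets n h
      ≡⟨ cong₂ _+_ (cong₂ _+_ (cong (sumSubsets n h +_) (sym (sumSubsets-toggle a h)))
                              (sym (sumSubsets-toggle b h)))
                   (sym (trans (sumSubsets-toggle b h₁) (sumSubsets-toggle a h))) ⟩
    sumSubsets n h + sumSubsets n h₁ + sumSubsets n h₂ + sumSubsets n h₃
      ≡⟨ linearity ⟨
    sumSubsets n (λ c → h c + h₁ c + h₂ c + h₃ c)
      ≡⟨ sumSubsets-cong h-toggles ⟩
    sumSubsets n (λ c → sumBool₂ g * f c)
      ≡⟨ sumSubsets-* (sumBool₂ g) f ⟩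
    sumBool₂ g * sumSubsets n f ∎
    where
    open ≡-Reasoning
    four : ∀ x → 4 * x ≡ x + x + x + x
    four = solve-∀
    h₁ h₂ h₃ : Subset n → ℕ
    h₁ = h ∘ toggle a
    h₂ = h ∘ toggle b
    h₃ = h ∘ toggle a ∘ toggle b
    linearity : sumSubsets n (λ c → h c + h₁ c + h₂ c + h₃ c)
                ≡ sumSubsets n h + sumSubsets n h₁ + sumSubsets n h₂ + sumSubsets n h₃
    linearity = begin
      sumSubsets n (λ c → h c + h₁ c + h₂ c + h₃ c)
        ≡⟨ sumSubsets-+ (λ c → h c + h₁ c + h₂ c) h₃ ⟩
      sumSubsets n (λ c → h c + h₁ c + h₂ c) + sumSubsets n h₃
        ≡⟨ cong (_+ sumSubsets n h₃) (sumSubsets-+ (λ c → h c + h₁ c) h₂) ⟩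
      sumSubsets n (λ c → h c + h₁ c) + sumSubsets n h₂ + sumSubsets n h₃
        ≡⟨ cong (λ s → s + sumSubsets n h₂ + sumSubsets n h₃) (sumSubsets-+ h h₁) ⟩
      sumSubsets n h + sumSubsets n h₁ + sumSubsets n h₂ + sumSubsets n h₃ ∎

endpoints : ∀ {A : Set} → List (A × A) → List A
endpoints [] = []
endpoints ((a , b) ∷ J) = a ∷ b ∷ endpoints J

pairProduct : ∀ {n} → (Bool → Bool → ℕ) → List (Fin n × Fin n) → Subset n → ℕ
pairProduct g [] c = 1
pairProduct g ((a , b) ∷ J) c = g (lookup c a) (lookup c b) * pairProduct g J c

pairProduct-toggle : ∀ {n} {x : Fin n} g J → All (x ≢_) (endpoints J) →
                     ∀ c → pairProduct g J (toggle x c) ≡ pairProduct g J c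
pairProduct-toggle g [] [] c = refl
pairProduct-toggle {x = x} g ((a , b) ∷ J) (x≢a ∷ x≢b ∷ x∉J) c =
  cong₂ _*_ (cong₂ g (lookup∘updateAt′ a x (x≢a ∘ sym) c) (lookup∘updateAt′ b x (x≢b ∘ sym) c))
            (pairProduct-toggle g J x∉J c)

sumSubsets-pairProduct : ∀ {n} g (J : List (Fin n × Fin n)) → Unique (endpoints J) →
  4 ^ length J * sumSubsets n (pairProduct g J) ≡ sumBool₂ g ^ length J * 2 ^ n
sumSubsets-pairProduct {n} g [] [] = cong (_+ 0) (trans (sumSubsets-const {n} 1) (*-identityʳ _))
sumSubsets-pairProduct {n} g ((a , b) ∷ J) ((a≢b ∷ a∉J) ∷ b∉J ∷ unique) = begin
  4 * 4 ^ length J * sumSubsets n (pairProduct g ((a , b) ∷ J))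
    ≡⟨ reassoc (4 ^ length J) _ ⟩
  4 ^ length J * (4 * sumSubsets n (pairProduct g ((a , b) ∷ J)))
    ≡⟨ cong (4 ^ length J *_) (sumSubsets-pair a≢b g (pairProduct g J)
                                 (pairProduct-toggle g J a∉J) (pairProduct-toggle g J b∉J)) ⟩
  4 ^ length J * (S * sumSubsets n (pairProduct g J))
    ≡⟨ x∙yz≈y∙xz (4 ^ length J) S _ ⟩
  S * (4 ^ length J * sumSubsets n (pairProduct g J))
    ≡⟨ cong (S *_) (sumSubsets-pairProduct g J unique) ⟩
  S * (S ^ length J * 2 ^ n)
    ≡⟨ *-assoc S _ _ ⟨
  S * S ^ length J * 2 ^ n ∎
  where
  open ≡-Reasoning
  S : ℕ
  S = sumBool₂ g
  reassoc : ∀ x y → 4 * x * y ≡ x * (4 * y)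
  reassoc = solve-∀

pairProduct≡0 : ∀ {n} g J (c : Subset n) → pairProduct g J c ≡ 0 →
                Any (uncurry λ a b → g (lookup c a) (lookup c b) ≡ 0) J
pairProduct≡0 g ((a , b) ∷ J) c ∏≡0 with m*n≡0⇒m≡0∨n≡0 (g (lookup c a) (lookup c b)) ∏≡0
... | inj₁ gab≡0 = here gab≡0
... | inj₂ ∏J≡0 = there (pairProduct≡0 g J c ∏J≡0)

x∈p─q⇒x∉q : ∀ {n} {p q : Subset n} {x} → x ∈ p ─ q → x ∉ q
x∈p─q⇒x∉q {p = _ ∷ _} {outside ∷ _} {zero} here ()
x∈p─q⇒x∉q {p = _ ∷ _} {inside ∷ _} {zero} () _
x∈p─q⇒x∉q {p = _ ∷ _} {_ ∷ _} (there x∈p─q) (there x∈q) = x∈p─q⇒x∉q x∈p─q x∈q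

[p∪q]─[p∪∁q]≡q─p : ∀ {n} (p q : Subset n) → (p ∪ q) ─ (p ∪ ∁ q) ≡ q ─ p
[p∪q]─[p∪∁q]≡q─p [] [] = refl
[p∪q]─[p∪∁q]≡q─p (inside ∷ p) (inside ∷ q) = cong (outside ∷_) ([p∪q]─[p∪∁q]≡q─p p q)
[p∪q]─[p∪∁q]≡q─p (inside ∷ p) (outside ∷ q) = cong (outside ∷_) ([p∪q]─[p∪∁q]≡q─p p q)
[p∪q]─[p∪∁q]≡q─p (outside ∷ p) (inside ∷ q) = cong (inside ∷_) ([p∪q]─[p∪∁q]≡q─p p q)
[p∪q]─[p∪∁q]≡q─p (outside ∷ p) (outside ∷ q) = cong (outside ∷_) ([p∪q]─[p∪∁q]≡q─p p q)

[p∪∁q]─[p∪q]≡∁q─p : ∀ {n} (p q : Subset n) → (p ∪ ∁ q) ─ (p ∪ q) ≡ ∁ q ─ p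
[p∪∁q]─[p∪q]≡∁q─p [] [] = refl
[p∪∁q]─[p∪q]≡∁q─p (inside ∷ p) (inside ∷ q) = cong (outside ∷_) ([p∪∁q]─[p∪q]≡∁q─p p q)
[p∪∁q]─[p∪q]≡∁q─p (inside ∷ p) (outside ∷ q) = cong (outside ∷_) ([p∪∁q]─[p∪q]≡∁q─p p q)
[p∪∁q]─[p∪q]≡∁q─p (outside ∷ p) (inside ∷ q) = cong (outside ∷_) ([p∪∁q]─[p∪q]≡∁q─p p q)
[p∪∁q]─[p∪q]≡∁q─p (outside ∷ p) (outside ∷ q) = cong (inside ∷_) ([p∪∁q]─[p∪q]≡∁q─p p q)

[p∪q]∩[p∪∁q]≡p : ∀ {n} (p q : Subset n) → (p ∪ q) ∩ (p ∪ ∁ q) ≡ p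
[p∪q]∩[p∪∁q]≡p [] [] = refl
[p∪q]∩[p∪∁q]≡p (inside ∷ p) (_ ∷ q) = cong (inside ∷_) ([p∪q]∩[p∪∁q]≡p p q)
[p∪q]∩[p∪∁q]≡p (outside ∷ p) (inside ∷ q) = cong (outside ∷_) ([p∪q]∩[p∪∁q]≡p p q)
[p∪q]∩[p∪∁q]≡p (outside ∷ p) (outside ∷ q) = cong (outside ∷_) ([p∪q]∩[p∪∁q]≡p p q)

x∈⁅y⁆∪⁅z⁆⁻ : ∀ {n} {x : Fin n} y z → x ∈ ⁅ y ⁆ ∪ ⁅ z ⁆ → x ≡ y ⊎ x ≡ z
x∈⁅y⁆∪⁅z⁆⁻ y z x∈⁅y⁆∪⁅z⁆ = Sum.map (x∈⁅y⁆⇒x≡y y) (x∈⁅y⁆⇒x≡y z) (x∈p∪q⁻ ⁅ y ⁆ ⁅ z ⁆ x∈⁅y⁆∪⁅z⁆)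

x∉⁅y⁆∪⁅z⁆ : ∀ {n} {x y z : Fin n} → x ≢ y → x ≢ z → x ∉ ⁅ y ⁆ ∪ ⁅ z ⁆
x∉⁅y⁆∪⁅z⁆ {y = y} {z} x≢y x≢z x∈⁅y⁆∪⁅z⁆ = [ x≢y , x≢z ]′ (x∈⁅y⁆∪⁅z⁆⁻ y z x∈⁅y⁆∪⁅z⁆)

∣⁅x⁆∪⁅y⁆∣≡2 : ∀ {n} {x y : Fin n} → x ≢ y → ∣ ⁅ x ⁆ ∪ ⁅ y ⁆ ∣ ≡ 2
∣⁅x⁆∪⁅y⁆∣≡2 {x = zero} {zero} x≢y = ⊥-elim (x≢y refl)
∣⁅x⁆∪⁅y⁆∣≡2 {x = zero} {suc y} _ = cong suc (trans (cong ∣_∣ (∪-identityˡ ⁅ y ⁆)) (∣⁅x⁆∣≡1 y))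
∣⁅x⁆∪⁅y⁆∣≡2 {x = suc x} {zero} _ = cong suc (trans (cong ∣_∣ (∪-identityʳ ⁅ x ⁆)) (∣⁅x⁆∣≡1 x))
∣⁅x⁆∪⁅y⁆∣≡2 {x = suc x} {suc y} x≢y = ∣⁅x⁆∪⁅y⁆∣≡2 (x≢y ∘ cong suc)

lookup≡outside⇒∉ : ∀ {n} {p : Subset n} {x} → lookup p x ≡ outside → x ∉ p
lookup≡outside⇒∉ px≡outside x∈p with trans (sym px≡outside) ([]=⇒lookup x∈p)
... | ()

∣p[x]≔outside∣<∣p∣ : ∀ {n} (p : Subset n) x → lookup p x ≡ inside → ∣ p [ x ]≔ outside ∣ < ∣ p ∣
∣p[x]≔outside∣<∣p∣ (inside ∷ p) zero refl = ≤-refl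
∣p[x]≔outside∣<∣p∣ (outside ∷ p) (suc x) px≡inside = ∣p[x]≔outside∣<∣p∣ p x px≡inside
∣p[x]≔outside∣<∣p∣ (inside ∷ p) (suc x) px≡inside = s≤s (∣p[x]≔outside∣<∣p∣ p x px≡inside)

avoidingPairs : ∀ {n} → Subset n → List (Fin n) → List (Fin n × Fin n)
avoidingPairs W [] = []
avoidingPairs W (a ∷ []) = []
avoidingPairs W (a ∷ b ∷ xs) =
  if lookup W a ∨ lookup W b then avoidingPairs W xs else (a , b) ∷ avoidingPairs W xs

module _ {n} (W : Subset n) where

  avoidingPairs-linked : ∀ {R : Fin n → Fin n → Set} {xs} → Linked R xs →
                         All (uncurry λ a b → a ∉ W × b ∉ W × R a b) (avoidingPairs W xs)
  avoidingPairs-linked [] = []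
  avoidingPairs-linked [-] = []
  avoidingPairs-linked {xs = a ∷ b ∷ xs} (Rab ∷ linked) with lookup W a in Wa | lookup W b in Wb
  ... | true | _ = avoidingPairs-linked (Linked.tail linked)
  ... | false | true = avoidingPairs-linked (Linked.tail linked)
  ... | false | false =
    (lookup≡outside⇒∉ Wa , lookup≡outside⇒∉ Wb , Rab) ∷ avoidingPairs-linked (Linked.tail linked)

  endpoints-avoidingPairs : ∀ {P : Fin n → Set} {xs} → All P xs → All P (endpoints (avoidingPairs W xs))
  endpoints-avoidingPairs [] = []
  endpoints-avoidingPairs (_ ∷ []) = []
  endpoints-avoidingPairs {xs = a ∷ b ∷ xs} (Pa ∷ Pb ∷ Pxs) with lookup W a ∨ lookup W b
  ... | true = endpoints-avoidingPairs Pxs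
  ... | false = Pa ∷ Pb ∷ endpoints-avoidingPairs Pxs

  avoidingPairs-unique : ∀ {xs} → Unique xs → Unique (endpoints (avoidingPairs W xs))
  avoidingPairs-unique [] = []
  avoidingPairs-unique (_ ∷ []) = []
  avoidingPairs-unique {a ∷ b ∷ xs} ((a≢b ∷ a∉xs) ∷ b∉xs ∷ unique) with lookup W a ∨ lookup W b
  ... | true = avoidingPairs-unique unique
  ... | false =
    (a≢b ∷ endpoints-avoidingPairs a∉xs) ∷ endpoints-avoidingPairs b∉xs ∷ avoidingPairs-unique unique

avoidingPairs-cong : ∀ {n} {W W′ : Subset n} {xs} → All (λ x → lookup W x ≡ lookup W′ x) xs →
                     avoidingPairs W xs ≡ avoidingPairs W′ xs
avoidingPairs-cong [] = refl
avoidingPairs-cong (_ ∷ []) = refl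
avoidingPairs-cong {W′ = W′} {a ∷ b ∷ xs} (Wa≡W′a ∷ Wb≡W′b ∷ W≡W′) rewrite Wa≡W′a | Wb≡W′b =
  cong₂ (if lookup W′ a ∨ lookup W′ b then_else_)
        (avoidingPairs-cong W≡W′) (cong ((a , b) ∷_) (avoidingPairs-cong W≡W′))

-- A pair meeting W at x is paid for by removing x from W.
length-avoidingPairs-hit : ∀ {n} (W : Subset n) x {xs} → lookup W x ≡ inside → All (x ≢_) xs →
  length xs ≤ suc (2 * ∣ W [ x ]≔ outside ∣ + 2 * length (avoidingPairs (W [ x ]≔ outside) xs)) →
  suc (suc (length xs)) ≤ suc (2 * ∣ W ∣ + 2 * length (avoidingPairs W xs))
length-avoidingPairs-hit {n} W x {xs} Wx x∉xs IH = begin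
  suc (suc (length xs))                                   ≤⟨ s≤s (s≤s IH) ⟩
  suc (suc (suc (2 * ∣ W′ ∣ + 2 * length (avoidingPairs W′ xs))))
    ≡⟨ cong (λ J → suc (suc (suc (2 * ∣ W′ ∣ + 2 * length J)))) W′-pairs ⟩
  suc (suc (suc (2 * ∣ W′ ∣ + 2 * m)))                    ≡⟨ cong suc (shuffle ∣ W′ ∣ (2 * m)) ⟩
  suc (2 * suc ∣ W′ ∣ + 2 * m)                            ≤⟨ s≤s (+-monoˡ-≤ (2 * m) (*-monoʳ-≤ 2 ∣W′∣<∣W∣)) ⟩
  suc (2 * ∣ W ∣ + 2 * m)                                 ∎
  where
  open ≤-Reasoning
  W′ : Subset n
  W′ = W [ x ]≔ outside
  m : ℕ
  m = length (avoidingPairs W xs)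
  ∣W′∣<∣W∣ : ∣ W′ ∣ < ∣ W ∣
  ∣W′∣<∣W∣ = ∣p[x]≔outside∣<∣p∣ W x Wx
  W′-pairs : avoidingPairs W′ xs ≡ avoidingPairs W xs
  W′-pairs = avoidingPairs-cong (All.map (λ x≢y → lookup∘update′ (x≢y ∘ sym) W outside) x∉xs)
  shuffle : ∀ a y → suc (suc (2 * a + y)) ≡ 2 * suc a + y
  shuffle = solve-∀

length-avoidingPairs : ∀ {n} (W : Subset n) {xs} → Unique xs →
                       length xs ≤ suc (2 * ∣ W ∣ + 2 * length (avoidingPairs W xs))
length-avoidingPairs W [] = z≤n
length-avoidingPairs W (_ ∷ []) = s≤s z≤n
length-avoidingPairs W {a ∷ b ∷ xs} ((_ ∷ a∉xs) ∷ b∉xs ∷ unique) with lookup W a in Wa | lookup W b in Wb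
... | true | _ =
  length-avoidingPairs-hit W a Wa a∉xs (length-avoidingPairs (W [ a ]≔ outside) unique)
... | false | true =
  length-avoidingPairs-hit W b Wb b∉xs (length-avoidingPairs (W [ b ]≔ outside) unique)
... | false | false =
  subst (λ t → suc (suc (length xs)) ≤ suc t) (shuffle (2 * ∣ W ∣) (length (avoidingPairs W xs)))
        (s≤s (s≤s (length-avoidingPairs W unique)))
  where
  shuffle : ∀ a m → suc (suc (a + 2 * m)) ≡ a + 2 * suc m
  shuffle = solve-∀

a*3^k<4^k-mono : ∀ a {k l} → a * 3 ^ k < 4 ^ k → k ≤ l → a * 3 ^ l < 4 ^ l
a*3^k<4^k-mono a {k} {l} a3^k<4^k k≤l = subst (λ e → a * 3 ^ e < 4 ^ e) (m∸n+n≡m k≤l) (raise (l ∸ k))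
  where
  raise : ∀ e → a * 3 ^ (e + k) < 4 ^ (e + k)
  raise zero = a3^k<4^k
  raise (suc e) = begin-strict
    a * (3 * 3 ^ (e + k))   ≡⟨ x∙yz≈y∙xz a 3 _ ⟩
    3 * (a * 3 ^ (e + k))   <⟨ *-monoʳ-< 3 (raise e) ⟩
    3 * 4 ^ (e + k)         ≤⟨ *-monoˡ-≤ (4 ^ (e + k)) (n≤1+n 3) ⟩
    4 * 4 ^ (e + k)         ∎
    where open ≤-Reasoning

m*m<n*n⇒m<n : ∀ {m n} → m * m < n * n → m < n
m*m<n*n⇒m<n {m} {n} m*m<n*n with m <? n
... | yes m<n = m<n
... | no m≮n = contradiction m*m<n*n (≤⇒≯ (*-mono-≤ (≮⇒≥ m≮n) (≮⇒≥ m≮n)))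

a²*3^k<4^k⇒a*3^m<4^m : ∀ a {k} m → a * a * 3 ^ k < 4 ^ k → k ≤ 2 * m → a * 3 ^ m < 4 ^ m
a²*3^k<4^k⇒a*3^m<4^m a {k} m a²3^k<4^k k≤2m = m*m<n*n⇒m<n (begin-strict
  a * 3 ^ m * (a * 3 ^ m)   ≡⟨ square a (3 ^ m) ⟩
  a * a * (3 ^ m * 3 ^ m)   ≡⟨ cong (a * a *_) (^-distribˡ-+-* 3 m m) ⟨
  a * a * 3 ^ (m + m)       <⟨ a*3^k<4^k-mono (a * a) a²3^k<4^k (subst (k ≤_) 2m≡m+m k≤2m) ⟩
  4 ^ (m + m)               ≡⟨ ^-distribˡ-+-* 4 m m ⟩
  4 ^ m * 4 ^ m             ∎)
  where
  open ≤-Reasoning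
  square : ∀ x y → x * y * (x * y) ≡ x * x * (y * y)
  square = solve-∀
  2m≡m+m : 2 * m ≡ m + m
  2m≡m+m = cong (m +_) (+-identityʳ m)

4^m*X≡3^m*N⇒a*X<N : ∀ a {m X N} .{{_ : NonZero N}} →
                    4 ^ m * X ≡ 3 ^ m * N → a * 3 ^ m < 4 ^ m → a * X < N
4^m*X≡3^m*N⇒a*X<N a {m} {X} {N} 4^mX≡3^mN a3^m<4^m = *-cancelˡ-< (4 ^ m) _ _ (begin-strict
  4 ^ m * (a * X)   ≡⟨ x∙yz≈y∙xz (4 ^ m) a X ⟩
  a * (4 ^ m * X)   ≡⟨ cong (a *_) 4^mX≡3^mN ⟩
  a * (3 ^ m * N)   ≡⟨ *-assoc a _ N ⟨
  a * 3 ^ m * N     <⟨ *-monoˡ-< N a3^m<4^m ⟩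
  4 ^ m * N         ∎)
  where open ≤-Reasoning

*-sum-map-< : ∀ {A : Set} k {N} (f : A → ℕ) → (∀ x → k * f x < N) →
              ∀ xs → k * sum (map f xs) + length xs ≤ length xs * N
*-sum-map-< k f k*f<N [] = ≤-reflexive (trans (+-identityʳ (k * 0)) (*-zeroʳ k))
*-sum-map-< k {N} f k*f<N (x ∷ xs) = begin
  k * (f x + sum (map f xs)) + suc (length xs)   ≡⟨ cong (_+ suc (length xs)) (*-distribˡ-+ k (f x) _) ⟩
  k * f x + k * sum (map f xs) + suc (length xs) ≡⟨ shuffle (k * f x) _ (length xs) ⟩
  suc (k * f x) + (k * sum (map f xs) + length xs) ≤⟨ +-mono-≤ (k*f<N x) (*-sum-map-< k f k*f<N xs) ⟩
  N + length xs * N                              ∎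
  where
  open ≤-Reasoning
  shuffle : ∀ a b c → a + b + suc c ≡ suc a + (b + c)
  shuffle = solve-∀

sum-allFin-< : ∀ {n N} .{{_ : NonZero n}} (f : Fin n → ℕ) → (∀ x → n * f x < N) →
               sum (map f (allFin n)) < N
sum-allFin-< {n} {N} f n*f<N = *-cancelˡ-≤ n (begin
  n * suc S    ≡⟨ trans (*-suc n S) (+-comm n (n * S)) ⟩
  n * S + n    ≡⟨ cong (λ l → n * S + l) length-allFin ⟨
  n * S + length (allFin n)   ≤⟨ *-sum-map-< n f n*f<N (allFin n) ⟩
  length (allFin n) * N       ≡⟨ cong (_* N) length-allFin ⟩
  n * N        ∎)
  where
  open ≤-Reasoning
  S : ℕ
  S = sum (map f (allFin n))
  length-allFin : length (allFin n) ≡ n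
  length-allFin = length-tabulate (λ i → i)

sum-map≡0 : ∀ {A : Set} (f : A → ℕ) {xs x} → sum (map f xs) ≡ 0 → x ∈ˡ xs → f x ≡ 0
sum-map≡0 f {y ∷ xs} Σ≡0 (here refl) = m+n≡0⇒m≡0 (f y) Σ≡0
sum-map≡0 f {y ∷ xs} Σ≡0 (there x∈xs) = sum-map≡0 f (m+n≡0⇒n≡0 (f y) Σ≡0) x∈xs

module Residues (p : ℕ) (pr : Prime p) where

  instance
    p≢0 : NonZero p
    p≢0 = prime⇒nonZero pr

  r : ℕ → Fin p
  r = res p pr

  infixl 6 _⊖_
  _⊖_ : Fin p → Fin p → Fin p
  _⊖_ = sub p pr

  infix 4 _≋_
  _≋_ : ℕ → ℕ → Set
  m ≋ n = m % p ≡ n % p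

  ≋-+ : ∀ {a b c d} → a ≋ b → c ≋ d → a + c ≋ b + d
  ≋-+ {a} {b} {c} {d} a≋b c≋d = begin
    (a + c) % p             ≡⟨ %-distribˡ-+ a c p ⟩
    (a % p + c % p) % p     ≡⟨ cong₂ (λ x y → (x + y) % p) a≋b c≋d ⟩
    (b % p + d % p) % p     ≡⟨ %-distribˡ-+ b d p ⟨
    (b + d) % p             ∎
    where open ≡-Reasoning

  %-≋ : ∀ m → m % p ≋ m
  %-≋ m = m%n%n≡m%n m p

  0%p≡0 : 0 % p ≡ 0
  0%p≡0 = m<n⇒m%n≡m (>-nonZero⁻¹ p)

  p≋0 : p ≋ 0
  p≋0 = trans (n%n≡0 p) (sym 0%p≡0)

  toℕ-r : ∀ m → toℕ (r m) ≋ m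
  toℕ-r m = trans (cong (_% p) (toℕ-fromℕ< (m%n<n m p))) (%-≋ m)

  ≋⇒≡ : ∀ {u v : Fin p} → toℕ u ≋ toℕ v → u ≡ v
  ≋⇒≡ {u} {v} u≋v =
    toℕ-injective (trans (sym (m<n⇒m%n≡m (toℕ<n u))) (trans u≋v (m<n⇒m%n≡m (toℕ<n v))))

  +-cancelʳ-≋ : ∀ a b c → a + c ≋ b + c → a ≋ b
  +-cancelʳ-≋ a b c a+c≋b+c = begin
    a % p               ≡⟨ cong (_% p) (+-identityʳ a) ⟨
    (a + 0) % p         ≡⟨ ≋-+ {a} refl c+e≋0 ⟨
    (a + (c + e)) % p   ≡⟨ cong (_% p) (+-assoc a c e) ⟨
    (a + c + e) % p     ≡⟨ ≋-+ {a + c} {b + c} {e} a+c≋b+c refl ⟩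
    (b + c + e) % p     ≡⟨ cong (_% p) (+-assoc b c e) ⟩
    (b + (c + e)) % p   ≡⟨ ≋-+ {b} refl c+e≋0 ⟩
    (b + 0) % p         ≡⟨ cong (_% p) (+-identityʳ b) ⟩
    b % p               ∎
    where
    open ≡-Reasoning
    e : ℕ
    e = p ∸ c % p
    c+e≋0 : c + e ≋ 0
    c+e≋0 = trans (≋-+ {c} {c % p} {e} (sym (%-≋ c)) refl)
                  (trans (cong (_% p) (m+[n∸m]≡n (m%n≤n c p))) p≋0)

  ≋-+⇒∣ : ∀ m k → m ≋ m + k → p ∣ k
  ≋-+⇒∣ m k m≋m+k = m%n≡0⇒n∣m k p (trans k≋0 0%p≡0)
    where
    k≋0 : k ≋ 0
    k≋0 = +-cancelʳ-≋ k 0 m (trans (cong (_% p) (+-comm k m)) (sym m≋m+k))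

  ⊖-spec : ∀ u v → toℕ (u ⊖ v) + toℕ v ≋ toℕ u
  ⊖-spec u v = begin
    (toℕ (u ⊖ v) + toℕ v) % p         ≡⟨ ≋-+ {toℕ (u ⊖ v)} (toℕ-r (toℕ u + (p ∸ toℕ v))) refl ⟩
    (toℕ u + (p ∸ toℕ v) + toℕ v) % p ≡⟨ cong (_% p) (+-assoc (toℕ u) _ _) ⟩
    (toℕ u + (p ∸ toℕ v + toℕ v)) % p ≡⟨ cong (λ x → (toℕ u + x) % p) (m∸n+n≡m (<⇒≤ (toℕ<n v))) ⟩
    (toℕ u + p) % p                   ≡⟨ [m+n]%n≡m%n (toℕ u) p ⟩
    toℕ u % p                         ∎
    where open ≡-Reasoning

  ⊖-unique : ∀ {u v w} → toℕ w + toℕ v ≋ toℕ u → u ⊖ v ≡ w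
  ⊖-unique {u} {v} {w} w+v≋u = ≋⇒≡ (+-cancelʳ-≋ _ _ (toℕ v) (trans (⊖-spec u v) (sym w+v≋u)))

  ⊖≡0⇒≡ : ∀ {u v} → toℕ (u ⊖ v) ≡ 0 → u ≡ v
  ⊖≡0⇒≡ {u} {v} u⊖v≡0 = sym (≋⇒≡ (trans (cong (λ x → (x + toℕ v) % p) (sym u⊖v≡0)) (⊖-spec u v)))

  ⊖≡id⇒0 : ∀ {u} d → u ⊖ d ≡ u → toℕ d ≡ 0
  ⊖≡id⇒0 {u} d u⊖d≡u = trans (sym (m<n⇒m%n≡m (toℕ<n d))) (trans d≋0 0%p≡0)
    where
    d≋0 : toℕ d ≋ 0
    d≋0 = +-cancelʳ-≋ (toℕ d) 0 (toℕ u)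
            (trans (cong (_% p) (+-comm (toℕ d) (toℕ u)))
                   (trans (cong (λ x → (toℕ x + toℕ d) % p) (sym u⊖d≡u)) (⊖-spec u d)))

  ⊖-involutive : ∀ u d → u ⊖ (u ⊖ d) ≡ d
  ⊖-involutive u d = ⊖-unique (trans (cong (_% p) (+-comm (toℕ d) _)) (⊖-spec u d))

  r[d+m]⊖r[m]≡d : ∀ d m → r (toℕ d + m) ⊖ r m ≡ d
  r[d+m]⊖r[m]≡d d m = ⊖-unique (trans (≋-+ {toℕ d} refl (toℕ-r m)) (sym (toℕ-r (toℕ d + m))))

  r-translate : ∀ {x k a b} d → r x ⊖ d ≡ r a → r (x + k) ⊖ d ≡ r b → r (a + k) ≡ r b
  r-translate {x} {k} {a} {b} d x⊖d≡a x+k⊖d≡b =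
    ≋⇒≡ (trans (toℕ-r (a + k)) (trans a+k≋b (sym (toℕ-r b))))
    where
    t : ℕ
    t = toℕ d
    ⊖≡r⇒≋ : ∀ {y c} → r y ⊖ d ≡ r c → c + t ≋ y
    ⊖≡r⇒≋ {y} {c} y⊖d≡c = begin
      (c + t) % p             ≡⟨ ≋-+ {c} (sym (toℕ-r c)) refl ⟩
      (toℕ (r c) + t) % p     ≡⟨ cong (λ z → (toℕ z + t) % p) y⊖d≡c ⟨
      (toℕ (r y ⊖ d) + t) % p ≡⟨ ⊖-spec (r y) d ⟩
      toℕ (r y) % p           ≡⟨ toℕ-r y ⟩
      y % p                   ∎
      where open ≡-Reasoning
    a+k≋b : a + k ≋ b
    a+k≋b = +-cancelʳ-≋ (a + k) b t (begin
      (a + k + t) % p   ≡⟨ cong (_% p) (+-assoc a k t) ⟩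
      (a + (k + t)) % p ≡⟨ cong (λ y → (a + y) % p) (+-comm k t) ⟩
      (a + (t + k)) % p ≡⟨ cong (_% p) (+-assoc a t k) ⟨
      (a + t + k) % p   ≡⟨ ≋-+ {a + t} {x} {k} (⊖≡r⇒≋ x⊖d≡a) refl ⟩
      (x + k) % p       ≡⟨ ⊖≡r⇒≋ x+k⊖d≡b ⟨
      (b + t) % p       ∎)
      where open ≡-Reasoning

  r[m]≢r[m+k] : ∀ m k → ¬ p ∣ k → r m ≢ r (m + k)
  r[m]≢r[m+k] m k p∤k rm≡rm+k =
    p∤k (≋-+⇒∣ m k (trans (sym (toℕ-r m)) (trans (cong (λ y → toℕ y % p) rm≡rm+k) (toℕ-r (m + k)))))

  0<k<p⇒p∤k : ∀ {k} → 0 < k → k < p → ¬ p ∣ k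
  0<k<p⇒p∤k {suc k} _ k<p p∣k = <-irrefl refl (<-≤-trans k<p (∣⇒≤ p∣k))

  ∤-* : ∀ {m n} → ¬ p ∣ m → ¬ p ∣ n → ¬ p ∣ m * n
  ∤-* {m} {n} p∤m p∤n p∣mn = [ p∤m , p∤n ]′ (euclidsLemma m n pr p∣mn)

  Difference : Subset p → Subset p → Fin p → Set
  Difference A B d = ∃[ u ] ∃[ v ] (u ∈ A × v ∈ B × u ⊖ v ≡ d)

  primeCompatible⁺ : ∀ {U V} → (∀ d → toℕ d ≢ 0 → Difference (U ─ V) (V ─ U) d) →
                     PrimeCompatible p pr U V
  primeCompatible⁺ {U} {V} cover d = mk⇔ (cover d) λ (u , v , u∈U─V , v∈V─U , u⊖v≡d) d≡0 →
    x∈p─q⇒x∉q v∈V─U (subst (_∈ U) (⊖≡0⇒≡ (trans (cong toℕ u⊖v≡d) d≡0)) (p─q⊆p U V u∈U─V))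

  ∪∁-primeCompatible : ∀ {W} C → Nonempty W → (∀ d → toℕ d ≢ 0 → Difference (C ─ W) (∁ C ─ W) d) →
                       Nonempty (W ∪ C) × Nonempty (W ∪ ∁ C) × PrimeCompatible p pr (W ∪ C) (W ∪ ∁ C)
                       × W ⊆ W ∪ C × W ⊆ W ∪ ∁ C
  ∪∁-primeCompatible {W} C (x , x∈W) cover =
    (x , p⊆p∪q C x∈W) , (x , p⊆p∪q (∁ C) x∈W) ,
    primeCompatible⁺ (λ d d≢0 → subst₂ (λ A B → Difference A B d)
      (sym ([p∪q]─[p∪∁q]≡q─p W C)) (sym ([p∪∁q]─[p∪q]≡∁q─p W C)) (cover d d≢0)) ,
    p⊆p∪q C , p⊆p∪q (∁ C)

module PartA {p} (pr : Prime p) (W : Subset p) where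

  open Residues p pr

  orbit : Fin p → List (Fin p)
  orbit d = applyUpTo (λ i → r (i * toℕ d)) p

  orbit-linked : ∀ d → Linked (λ a b → b ⊖ a ≡ d) (orbit d)
  orbit-linked d = Linked.applyUpTo⁺₂ _ p (λ i → r[d+m]⊖r[m]≡d d (i * toℕ d))

  orbit-unique : ∀ {d} → toℕ d ≢ 0 → Unique (orbit d)
  orbit-unique {d} d≢0 = Unique.applyUpTo⁺₁ _ p distinct
    where
    t : ℕ
    t = toℕ d
    distinct : ∀ {i j} → i < j → j < p → r (i * t) ≢ r (j * t)
    distinct {i} {j} i<j j<p =
      subst (λ x → r (i * t) ≢ r x) it+[j∸i]t≡jt
        (r[m]≢r[m+k] (i * t) ((j ∸ i) * t)
          (∤-* (0<k<p⇒p∤k (m<n⇒0<n∸m i<j) (≤-<-trans (m∸n≤m j i) j<p))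
               (0<k<p⇒p∤k (n≢0⇒n>0 d≢0) (toℕ<n d))))
      where
      it+[j∸i]t≡jt : i * t + (j ∸ i) * t ≡ j * t
      it+[j∸i]t≡jt = trans (sym (*-distribʳ-+ t i (j ∸ i))) (cong (_* t) (m+[n∸m]≡n (<⇒≤ i<j)))

  pairs : Fin p → List (Fin p × Fin p)
  pairs d = avoidingPairs W (orbit d)

  -- For a pair (a , b) with b ⊖ a ≡ d, unsplit (lookup C a) (lookup C b) ≡ 0 exactly when
  -- b ∈ C and a ∉ C, i.e. when the pair realises d as a difference of C ─ W and ∁ C ─ W.
  unsplit : Bool → Bool → ℕ
  unsplit false true = 0
  unsplit _ _ = 1

  unsplit≡0 : ∀ x y → unsplit x y ≡ 0 → x ≡ false × y ≡ true
  unsplit≡0 false true _ = refl , refl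

  missed : (d : Fin p) → Dec (toℕ d ≡ 0) → Subset p → ℕ
  missed d (yes _) C = 0
  missed d (no _) C = pairProduct unsplit (pairs d) C

  missedTotal : Subset p → ℕ
  missedTotal C = sum (map (λ d → missed d (toℕ d ≟ 0) C) (allFin p))

  difference : ∀ C d dec → missed d dec C ≡ 0 → toℕ d ≢ 0 → Difference (C ─ W) (∁ C ─ W) d
  difference C d (yes d≡0) _ d≢0 = contradiction d≡0 d≢0
  difference C d (no _) missed≡0 _ with All.lookupAny (avoidingPairs-linked W (orbit-linked d))
                                                      (pairProduct≡0 unsplit (pairs d) C missed≡0)
  ... | (a∉W , b∉W , b⊖a≡d) , unsplit[Ca,Cb]≡0 with unsplit≡0 _ _ unsplit[Ca,Cb]≡0
  ... | Ca≡outside , Cb≡inside =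
    _ , _ , x∈p∧x∉q⇒x∈p─q (lookup⇒[]= _ C Cb≡inside) b∉W ,
    x∈p∧x∉q⇒x∈p─q (x∉p⇒x∈∁p (lookup≡outside⇒∉ Ca≡outside)) a∉W , b⊖a≡d

  module _ (H : p * p * 3 ^ (p ∸ 1 ∸ 2 * ∣ W ∣) < 4 ^ (p ∸ 1 ∸ 2 * ∣ W ∣)) where

    p*3^m<4^m : ∀ {d} → toℕ d ≢ 0 → p * 3 ^ length (pairs d) < 4 ^ length (pairs d)
    p*3^m<4^m {d} d≢0 = a²*3^k<4^k⇒a*3^m<4^m p (length (pairs d)) H
      (m≤n+o⇒m∸n≤o (p ∸ 1) (2 * ∣ W ∣) (m≤n+o⇒m∸n≤o p 1 p≤1+2∣W∣+2m))
      where
      p≤1+2∣W∣+2m : p ≤ suc (2 * ∣ W ∣ + 2 * length (pairs d))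
      p≤1+2∣W∣+2m = subst (_≤ suc (2 * ∣ W ∣ + 2 * length (pairs d))) (length-applyUpTo _ p)
                          (length-avoidingPairs W (orbit-unique d≢0))

    p*Σmissed<2^p : ∀ d dec → p * sumSubsets p (missed d dec) < 2 ^ p
    p*Σmissed<2^p d (yes _) = subst (_< 2 ^ p) (sym Σ≡0) (m^n>0 2 p)
      where
      Σ≡0 : p * sumSubsets p (λ _ → 0) ≡ 0
      Σ≡0 = trans (cong (p *_) (trans (sumSubsets-const {p} 0) (*-zeroʳ (2 ^ p)))) (*-zeroʳ p)
    p*Σmissed<2^p d (no d≢0) = 4^m*X≡3^m*N⇒a*X<N p {length (pairs d)} {{m^n≢0 2 p}}
      (sumSubsets-pairProduct unsplit (pairs d) (avoidingPairs-unique W (orbit-unique d≢0)))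
      (p*3^m<4^m d≢0)

    ∃-missedTotal≡0 : ∃[ C ] missedTotal C ≡ 0
    ∃-missedTotal≡0 = sumSubsets<2^n⇒∃≡0 missedTotal
      (subst (_< 2 ^ p) (sym (sumSubsets-sum (allFin p) (λ d → missed d (toℕ d ≟ 0))))
             (sum-allFin-< _ (λ d → p*Σmissed<2^p d (toℕ d ≟ 0))))

  partA : Nonempty W → p * p * 3 ^ (p ∸ 1 ∸ 2 * ∣ W ∣) < 4 ^ (p ∸ 1 ∸ 2 * ∣ W ∣) →
          ∃[ U ] ∃[ V ] (Nonempty U × Nonempty V × PrimeCompatible p pr U V × W ⊆ U × W ⊆ V)
  partA W≢∅ H =
    let C , missedTotal≡0 = ∃-missedTotal≡0 H in
    W ∪ C , W ∪ ∁ C , ∪∁-primeCompatible C W≢∅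
      (λ d → difference C d (toℕ d ≟ 0) (sum-map≡0 _ missedTotal≡0 (∈-allFin d)))

module PartB {p} (pr : Prime p) (7≤p : 7 ≤ p) where

  open Residues p pr

  p∤small : ∀ k {0<k : True (0 <? k)} {k<7 : True (k <? 7)} → ¬ p ∣ k
  p∤small k {0<k} {k<7} = 0<k<p⇒p∤k (toWitness 0<k) (<-≤-trans (toWitness k<7) 7≤p)

  p∤1800 : ¬ p ∣ 1800
  p∤1800 = ∤-* (p∤small 2) (∤-* (p∤small 5) (∤-* (p∤small 5) (∤-* (p∤small 6) (p∤small 6))))

  -- Every difference between the residues used below divides 1800 = 2³ · 3² · 5².
  gap : ∀ m k {k∣1800 : True (k ∣? 1800)} → r m ≢ r (m + k)
  gap m k {k∣1800} = r[m]≢r[m+k] m k (p∤1800 ∘ flip ∣-trans (toWitness k∣1800))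

  W C : Subset p
  W = ⁅ r 31 ⁆ ∪ ⁅ r 51 ⁆
  C = ⁅ r 1 ⁆ ∪ ⁅ r 11 ⁆

  r1∉W : r 1 ∉ W
  r1∉W = x∉⁅y⁆∪⁅z⁆ (gap 1 30) (gap 1 50)

  r11∉W : r 11 ∉ W
  r11∉W = x∉⁅y⁆∪⁅z⁆ (gap 11 20) (gap 11 40)

  r1∈C : r 1 ∈ C
  r1∈C = x∈p∪q⁺ (inj₁ (x∈⁅x⁆ (r 1)))

  r11∈C : r 11 ∈ C
  r11∈C = x∈p∪q⁺ (inj₂ (x∈⁅x⁆ (r 11)))

  r6∈∁C─W : r 6 ∈ ∁ C ─ W
  r6∈∁C─W = x∈p∧x∉q⇒x∈p─q (x∉p⇒x∈∁p (x∉⁅y⁆∪⁅z⁆ (gap 1 5 ∘ sym) (gap 6 5)))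
                          (x∉⁅y⁆∪⁅z⁆ (gap 6 25) (gap 6 45))

  ∈W∪C⁻ : ∀ {x} → x ∈ W ∪ C → (x ≡ r 31 ⊎ x ≡ r 51) ⊎ (x ≡ r 1 ⊎ x ≡ r 11)
  ∈W∪C⁻ x∈W∪C = Sum.map (x∈⁅y⁆∪⁅z⁆⁻ _ _) (x∈⁅y⁆∪⁅z⁆⁻ _ _) (x∈p∪q⁻ W C x∈W∪C)

  shift : ∀ d {a b} → r 1 ⊖ d ≡ r a → r 11 ⊖ d ≡ r b → r (a + 10) ≡ r b
  shift d = r-translate {x = 1} {k = 10} d

  ⊖-not-both-in-W∪C : ∀ {d} → toℕ d ≢ 0 → r 1 ⊖ d ∈ W ∪ C → r 11 ⊖ d ∈ W ∪ C → ⊥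
  ⊖-not-both-in-W∪C {d} d≢0 a∈ b∈ with ∈W∪C⁻ a∈ | ∈W∪C⁻ b∈
  ... | inj₂ (inj₁ a≡1) | _ = d≢0 (⊖≡id⇒0 d a≡1)
  ... | _ | inj₂ (inj₂ b≡11) = d≢0 (⊖≡id⇒0 d b≡11)
  ... | inj₁ (inj₁ a≡31) | inj₁ (inj₁ b≡31) = gap 31 10 (sym (shift d a≡31 b≡31))
  ... | inj₁ (inj₁ a≡31) | inj₁ (inj₂ b≡51) = gap 41 10 (shift d a≡31 b≡51)
  ... | inj₁ (inj₁ a≡31) | inj₂ (inj₁ b≡1) = gap 1 40 (sym (shift d a≡31 b≡1))
  ... | inj₁ (inj₂ a≡51) | inj₁ (inj₁ b≡31) = gap 31 30 (sym (shift d a≡51 b≡31))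
  ... | inj₁ (inj₂ a≡51) | inj₁ (inj₂ b≡51) = gap 51 10 (sym (shift d a≡51 b≡51))
  ... | inj₁ (inj₂ a≡51) | inj₂ (inj₁ b≡1) = gap 1 60 (sym (shift d a≡51 b≡1))
  ... | inj₂ (inj₂ a≡11) | inj₁ (inj₁ b≡31) = gap 21 10 (shift d a≡11 b≡31)
  ... | inj₂ (inj₂ a≡11) | inj₁ (inj₂ b≡51) = gap 21 30 (shift d a≡11 b≡51)
  ... | inj₂ (inj₂ a≡11) | inj₂ (inj₁ b≡1) = gap 1 20 (sym (shift d a≡11 b≡1))

  differenceVia : ∀ {d} u → u ∈ C → u ∉ W → u ⊖ d ∉ W ∪ C → Difference (C ─ W) (∁ C ─ W) d
  differenceVia {d} u u∈C u∉W v∉W∪C =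
    u , u ⊖ d , x∈p∧x∉q⇒x∈p─q u∈C u∉W ,
    x∈p∧x∉q⇒x∈p─q (x∉p⇒x∈∁p (v∉W∪C ∘ x∈p∪q⁺ ∘ inj₂)) (v∉W∪C ∘ x∈p∪q⁺ ∘ inj₁) ,
    ⊖-involutive u d

  difference : ∀ d → toℕ d ≢ 0 → Difference (C ─ W) (∁ C ─ W) d
  difference d d≢0 with r 1 ⊖ d ∈? W ∪ C | r 11 ⊖ d ∈? W ∪ C
  ... | no a∉W∪C | _ = differenceVia (r 1) r1∈C r1∉W a∉W∪C
  ... | yes _ | no b∉W∪C = differenceVia (r 11) r11∈C r11∉W b∉W∪C
  ... | yes a∈W∪C | yes b∈W∪C = ⊥-elim (⊖-not-both-in-W∪C d≢0 a∈W∪C b∈W∪C)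

  partB : ∃[ U ] ∃[ V ] (Nonempty U × Nonempty V × PrimeCompatible p pr U V
            × r 1 ∈ (U ─ V) × r 11 ∈ (U ─ V) × r 6 ∈ (V ─ U) × ∣ U ∩ V ∣ ≡ 2)
  partB =
    let U≢∅ , V≢∅ , compatible , _ =
          ∪∁-primeCompatible C (r 31 , x∈p∪q⁺ (inj₁ (x∈⁅x⁆ (r 31)))) difference
    in W ∪ C , W ∪ ∁ C , U≢∅ , V≢∅ , compatible ,
       subst (r 1 ∈_) U─V≡C─W (x∈p∧x∉q⇒x∈p─q r1∈C r1∉W) ,
       subst (r 11 ∈_) U─V≡C─W (x∈p∧x∉q⇒x∈p─q r11∈C r11∉W) ,
       subst (r 6 ∈_) (sym ([p∪∁q]─[p∪q]≡∁q─p W C)) r6∈∁C─W ,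
       trans (cong ∣_∣ ([p∪q]∩[p∪∁q]≡p W C)) (∣⁅x⁆∪⁅y⁆∣≡2 (gap 31 20))
    where
    U─V≡C─W : C ─ W ≡ (W ∪ C) ─ (W ∪ ∁ C)
    U─V≡C─W = sym ([p∪q]─[p∪∁q]≡q─p W C)

mainTheorem3 :
    ((p : ℕ) (pr : Prime p) (W : Subset p) →
      Nonempty W →
      p * p * 3 ^ (p ∸ 1 ∸ 2 * ∣ W ∣) < 4 ^ (p ∸ 1 ∸ 2 * ∣ W ∣) →
      ∃[ U ] ∃[ V ] (Nonempty U × Nonempty V × PrimeCompatible p pr U V × W ⊆ U × W ⊆ V))
    ×
    ((p : ℕ) (pr : Prime p) → 7 ≤ p →
      ∃[ U ] ∃[ V ] (Nonempty U × Nonempty V × PrimeCompatible p pr U V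
        × res p pr 1 ∈ (U ─ V) × res p pr 11 ∈ (U ─ V) × res p pr 6 ∈ (V ─ U)
        × ∣ U ∩ V ∣ ≡ 2))
mainTheorem3 = (λ p pr W → PartA.partA pr W) , (λ p pr 7≤p → PartB.partB pr 7≤p)
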